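{- Let $j$ be a positive integer and $D$ a $(2,j)$ digraph. Then $\omega(P(D))\le j+2$ if $j\le 2$, and $\omega(P(D))\le j+3$ if $j\ge 3$. Moreover, these bounds are tight: for every positive integer $j$ there is a $(2,j)$ digraph $D$ for which equality holds.
   Context: All digraphs are finite and simple. A $(2,j)$ digraph is an acyclic digraph in which every vertex has indegree at most $2$ and outdegree at most $j$. For an acyclic digraph $D$, the phylogeny graph $P(D)$ has vertex set $V(D)$, with $u\ne v$ adjacent iff $(u,v)\in A(D)$, or $(v,u)\in A(D)$, or $u$ and $v$ have a common out-neighbor in $D$. $\omega(G)$ denotes the clique number of $G$. -}

module Defs where

open import Data.Nat using (ℕ; suc; _≤_; _+_)
open import Data.Fin using (Fin)
open import Data.Bool using (Bool; true)
open import Data.List using (List; length; filter)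
open import Data.List.Relation.Unary.Unique.Propositional using (Unique)
open import Data.List.Membership.Propositional using (_∈_)
open import Data.Vec.Functional using (Vector)
open import Data.Fin.Subset using (Subset; ∣_∣)
open import Data.Vec using (tabulate)
open import Data.Product using (∃; _×_)
open import Data.Sum using (_⊎_)
open import Relation.Binary.PropositionalEquality using (_≡_)
open import Relation.Nullary using (¬_)

record Digraph : Set where
  field
    n   : ℕ
    arc : Fin n → Fin n → Bool

open Digraph public

_⟶[_]_ : (D : Digraph) → Fin (n D) → Fin (n D) → Set
_⟶[_]_ = λ D u v → arc D u v ≡ true
infix 4 _⟶[_]_

data Path (D : Digraph) : Fin (n D) → Fin (n D) → Set where
  step : ∀ {u v} → arc D u v ≡ true → Path D u v
  _∷ₚ_ : ∀ {u v w} → arc D u v ≡ true → Path D v w → Path D u w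

-- Simple: no loops (multiple arcs are impossible by representation)
Loopless : Digraph → Set
Loopless D = ∀ u → ¬ (arc D u u ≡ true)

Acyclic : Digraph → Set
Acyclic D = ∀ u → ¬ Path D u u

outNbhd : (D : Digraph) → Fin (n D) → Subset (n D)
outNbhd D u = tabulate (λ v → arc D u v)

inNbhd : (D : Digraph) → Fin (n D) → Subset (n D)
inNbhd D v = tabulate (λ u → arc D u v)

outdeg indeg : (D : Digraph) → Fin (n D) → ℕ
outdeg D u = ∣ outNbhd D u ∣
indeg  D v = ∣ inNbhd D v ∣

Is2j : ℕ → Digraph → Set
Is2j j D = Loopless D × Acyclic D × (∀ v → indeg D v ≤ 2) × (∀ v → outdeg D v ≤ j)

-- adjacency in the phylogeny graph P(D)
PAdj : (D : Digraph) → Fin (n D) → Fin (n D) → Set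
PAdj D u v = ¬ (u ≡ v) ×
  (arc D u v ≡ true ⊎ arc D v u ≡ true ⊎
   ∃ (λ w → arc D u w ≡ true × arc D v w ≡ true))

IsPClique : (D : Digraph) → List (Fin (n D)) → Set
IsPClique D xs = Unique xs × (∀ {u v} → u ∈ xs → v ∈ xs → ¬ (u ≡ v) → PAdj D u v)

CliqueNumberLE : Digraph → ℕ → Set
CliqueNumberLE D k = ∀ (xs : List (Fin (n D))) → IsPClique D xs → length xs ≤ k

CliqueNumberEq : Digraph → ℕ → Set
CliqueNumberEq D k = CliqueNumberLE D k × ∃ (λ xs → IsPClique D xs × length xs ≡ k)

bound : ℕ → ℕ
bound 0 = 2
bound 1 = 3
bound 2 = 4
bound (suc (suc (suc j))) = suc (suc (suc j)) + 3

module Submission where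

-- An acyclic digraph has, inside every clique K of P(D), a *sink* s: a
-- member with no arc into K.  Every other member u of K is adjacent to s in P(D)
-- without s ⟶ u, so either u ⟶ s, or u and s share an out-neighbour w.  At most two
-- vertices are of the first kind (indeg s ≤ 2), and the second kind injects into the
-- out-neighbourhood of s (w has at most one in-neighbour besides s), so |K| ≤ 1+2+j.
-- For j = 1 and j = 2 a finer case analysis on a clique of size j+3 (using also a
-- *source* of the clique when j = 2) shows that such a clique cannot exist.
--
-- For j = 1, 2 small digraphs are checked by evaluation.  For j ≥ 3 we
-- build a digraph on a vertex type with three sources, j centres and auxiliary
-- vertices, and transport it to Fin N along a bijection; the sources together with
-- the centres form a clique of size j+3.

open import Defs
open import Data.Nat using (ℕ; zero; suc; _+_; _*_; _≤_; _<_; z≤n; s≤s; _≤?_; _<?_)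
open import Data.Nat.Properties
  using (≤-refl; ≤-reflexive; ≤-trans; <-≤-trans; +-mono-≤; +-comm; +-suc; m≤n⇒m≤1+n;
         <-irrefl; <-trans)
open import Data.Fin using (Fin; zero; suc; toℕ; #_; punchIn; punchOut) renaming (_<_ to _<ᶠ_)
open import Data.Fin.Properties
  using (_≟_; all?; any?; punchIn-punchOut; <⇒≢; <-asym; <-cmp; +↔⊎; *↔×) renaming (_<?_ to _<ᶠ?_)
open import Data.Fin.Subset using (Subset; ∣_∣; _-_; ⁅_⁆; inside; outside)
  renaming (⊥ to ∅; _∈_ to _∈ₛ_)
open import Data.Fin.Subset.Properties
  using (x∈p⇒∣p-x∣<∣p∣; x∈p∧x≢y⇒x∈p-y; p⊆q⇒∣p∣≤∣q∣; p─q⊆p; p─⊥≡p; ∣⊥∣≡0; ∣⁅x⁆∣≡1; x∈⁅x⁆)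
open import Data.Fin.Induction using (spo-wellFounded)
open import Data.Bool using (Bool; true)
import Data.Bool.Properties as Bool
open import Data.List using (List; []; _∷_; _++_; length; filter; map; allFin)
open import Data.List.Relation.Unary.All as All using (All; []; _∷_)
open import Data.List.Relation.Unary.Any using (here; there)
import Data.List.Relation.Unary.Any as Any
open import Data.List.Relation.Unary.AllPairs using ([]; _∷_; allPairs?)
open import Data.List.Relation.Unary.Unique.Propositional using (Unique)
import Data.List.Relation.Unary.Unique.Propositional.Properties as Unique
open import Data.List.Membership.Propositional using (_∈_; find; lose)
open import Data.List.Membership.Propositional.Properties
  using (∈-filter⁻; ∈-++⁺ˡ; ∈-++⁻; ∈-map⁺; ∈-map⁻; ∈-allFin)
open import Data.List.Properties using (length-map; length-tabulate)
open import Data.Vec using (_∷_; tabulate; here; there)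
open import Data.Vec.Properties using (lookup∘tabulate; lookup⇒[]=; []=⇒lookup)
open import Data.Product using (∃; ∃-syntax; _×_; _,_; proj₁; proj₂)
open import Data.Product.Properties using (≡-dec)
open import Data.Sum using (_⊎_; inj₁; inj₂)
open import Data.Empty using (⊥; ⊥-elim)
open import Function using (id; case_of_)
open import Function.Bundles using (_↔_; Inverse; mk↔ₛ′)
open import Function.Properties.Inverse using (↔-refl; ↔-sym; ↔-trans)
open import Data.Sum.Function.Propositional using (_⊎-↔_)
open import Induction.WellFounded using (Acc; acc; WellFounded)
open import Relation.Binary.Structures using (IsStrictPartialOrder)
open import Relation.Binary.Definitions using (tri<; tri≈; tri>)
open import Relation.Nullary using (¬_; Dec; yes; no; ¬?; does)
open import Relation.Nullary.Decidable
  using (True; toWitness; dec-true; from-yes; map′; _×-dec_; _⊎-dec_; _→-dec_)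
open import Relation.Binary.PropositionalEquality
  using (_≡_; _≢_; refl; sym; trans; cong; subst; subst₂; ≢-sym; resp₂; isEquivalence;
         module ≡-Reasoning)

count-≤ : ∀ {N} {X : Set} (R : X → Fin N → Set) →
          (∀ {u u′ w} → R u w → R u′ w → u ≡ u′) →
          (S : Subset N) (B : List X) → Unique B →
          All (λ u → ∃[ w ] (w ∈ₛ S × R u w)) B → length B ≤ ∣ S ∣
count-≤ R functional S [] _ _ = z≤n
count-≤ R functional S (u ∷ B) (u∉B ∷ uniq) ((w , w∈S , uRw) ∷ ws) =
  <-≤-trans (s≤s (count-≤ R functional (S - w) B uniq (All.zipWith shrink (u∉B , ws))))
            (x∈p⇒∣p-x∣<∣p∣ w∈S)
  where
  -- the witness of any other member of B differs from w, so lies in S - w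
  shrink : ∀ {x} → u ≢ x × ∃[ w′ ] (w′ ∈ₛ S × R x w′) → ∃[ w′ ] (w′ ∈ₛ S - w × R x w′)
  shrink (u≢x , w′ , w′∈S , xRw′) =
    w′ , x∈p∧x≢y⇒x∈p-y w′∈S (λ { refl → u≢x (functional uRw xRw′) }) , xRw′

∣p∣≤1+∣p-x∣ : ∀ {N} (p : Subset N) (x : Fin N) → ∣ p ∣ ≤ suc ∣ p - x ∣
∣p∣≤1+∣p-x∣ (inside  ∷ p) zero    = s≤s (≤-reflexive (cong ∣_∣ (sym (p─⊥≡p p))))
∣p∣≤1+∣p-x∣ (outside ∷ p) zero    = m≤n⇒m≤1+n (≤-reflexive (cong ∣_∣ (sym (p─⊥≡p p))))
∣p∣≤1+∣p-x∣ (inside  ∷ p) (suc x) = s≤s (∣p∣≤1+∣p-x∣ p x)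
∣p∣≤1+∣p-x∣ (outside ∷ p) (suc x) = ∣p∣≤1+∣p-x∣ p x

x∉p-x : ∀ {N} (p : Subset N) (x : Fin N) → ¬ (x ∈ₛ p - x)
x∉p-x (_ ∷ p) zero    ()
x∉p-x (_ ∷ p) (suc x) (there x∈p-x) = x∉p-x p x x∈p-x

∣p∣≤length : ∀ {N} (p : Subset N) (L : List (Fin N)) →
             (∀ {v} → v ∈ₛ p → v ∈ L) → ∣ p ∣ ≤ length L
∣p∣≤length {N} p [] covered =
  ≤-trans (p⊆q⇒∣p∣≤∣q∣ {q = ∅} (λ v∈p → case covered v∈p of λ ())) (≤-reflexive (∣⊥∣≡0 N))
∣p∣≤length p (x ∷ L) covered =
  ≤-trans (∣p∣≤1+∣p-x∣ p x) (s≤s (∣p∣≤length (p - x) L covered′))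
  where
  covered′ : ∀ {v} → v ∈ₛ p - x → v ∈ L
  covered′ v∈p-x with covered (p─q⊆p p ⁅ x ⁆ v∈p-x)
  ... | there v∈L = v∈L
  ... | here refl = ⊥-elim (x∉p-x p x v∈p-x)

∈ₛ-tabulate⁺ : ∀ {N} (f : Fin N → Bool) {v} → f v ≡ true → v ∈ₛ tabulate f
∈ₛ-tabulate⁺ f {v} fv = lookup⇒[]= v (tabulate f) (trans (lookup∘tabulate f v) fv)

∈ₛ-tabulate⁻ : ∀ {N} (f : Fin N → Bool) {v} → v ∈ₛ tabulate f → f v ≡ true
∈ₛ-tabulate⁻ f {v} v∈ = trans (sym (lookup∘tabulate f v)) ([]=⇒lookup v∈)

length-filter-split : ∀ {A : Set} {P : A → Set} (P? : ∀ x → Dec (P x)) (xs : List A) →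
                      length xs ≡ length (filter P? xs) + length (filter (λ x → ¬? (P? x)) xs)
length-filter-split P? [] = refl
length-filter-split P? (x ∷ xs) with P? x
... | yes _ = cong suc (length-filter-split P? xs)
... | no  _ = trans (cong suc (length-filter-split P? xs)) (sym (+-suc _ _))

in-neighbours≤indeg : ∀ (D : Digraph) v (B : List (Fin (n D))) → Unique B →
                      All (λ u → D ⟶[ u ] v) B → length B ≤ indeg D v
in-neighbours≤indeg D v B uniq into = count-≤ _≡_ (λ p q → trans p (sym q)) (inNbhd D v) B uniq
  (All.map (λ {u} u→v → u , ∈ₛ-tabulate⁺ (λ x → arc D x v) u→v , refl) into)

out-neighbours≤outdeg : ∀ (D : Digraph) v (B : List (Fin (n D))) → Unique B →
                        All (λ u → D ⟶[ v ] u) B → length B ≤ outdeg D v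
out-neighbours≤outdeg D v B uniq from = count-≤ _≡_ (λ p q → trans p (sym q)) (outNbhd D v) B uniq
  (All.map (λ {u} v→u → u , ∈ₛ-tabulate⁺ (arc D v) v→u , refl) from)

indeg≤length : ∀ (D : Digraph) v (L : List (Fin (n D))) →
               (∀ {u} → D ⟶[ u ] v → u ∈ L) → indeg D v ≤ length L
indeg≤length D v L complete =
  ∣p∣≤length (inNbhd D v) L (λ u∈ → complete (∈ₛ-tabulate⁻ (λ x → arc D x v) u∈))

outdeg≤length : ∀ (D : Digraph) v (L : List (Fin (n D))) →
                (∀ {u} → D ⟶[ v ] u → u ∈ L) → outdeg D v ≤ length L
outdeg≤length D v L complete = ∣p∣≤length (outNbhd D v) L (λ u∈ → complete (∈ₛ-tabulate⁻ (arc D v) u∈))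

noThreeIn : ∀ (D : Digraph) {v a b c} → indeg D v ≤ 2 → a ≢ b → a ≢ c → b ≢ c →
            D ⟶[ a ] v → D ⟶[ b ] v → D ⟶[ c ] v → ⊥
noThreeIn D {v} deg a≢b a≢c b≢c a→v b→v c→v
  with ≤-trans (in-neighbours≤indeg D v (_ ∷ _ ∷ _ ∷ []) ((a≢b ∷ a≢c ∷ []) ∷ (b≢c ∷ []) ∷ [] ∷ [])
                  (a→v ∷ b→v ∷ c→v ∷ [])) deg
... | s≤s (s≤s ())

noThreeOut : ∀ (D : Digraph) {v a b c} → outdeg D v ≤ 2 → a ≢ b → a ≢ c → b ≢ c →
             D ⟶[ v ] a → D ⟶[ v ] b → D ⟶[ v ] c → ⊥
noThreeOut D {v} deg a≢b a≢c b≢c v→a v→b v→c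
  with ≤-trans (out-neighbours≤outdeg D v (_ ∷ _ ∷ _ ∷ []) ((a≢b ∷ a≢c ∷ []) ∷ (b≢c ∷ []) ∷ [] ∷ [])
                  (v→a ∷ v→b ∷ v→c ∷ [])) deg
... | s≤s (s≤s ())

noTwoOut : ∀ (D : Digraph) {v a b} → outdeg D v ≤ 1 → a ≢ b → D ⟶[ v ] a → D ⟶[ v ] b → ⊥
noTwoOut D {v} deg a≢b v→a v→b
  with ≤-trans (out-neighbours≤outdeg D v (_ ∷ _ ∷ []) ((a≢b ∷ []) ∷ [] ∷ []) (v→a ∷ v→b ∷ [])) deg
... | s≤s ()

_++ₚ_ : ∀ {D : Digraph} {u v w} → Path D u v → Path D v w → Path D u w
step u→v   ++ₚ q = u→v ∷ₚ q
(u→x ∷ₚ p) ++ₚ q = u→x ∷ₚ (p ++ₚ q)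

-- v is strictly reachable from u.  In an acyclic digraph this is a strict partial
-- order on the finite set Fin n, hence well-founded.
ReachableFrom : (D : Digraph) → Fin (n D) → Fin (n D) → Set
ReachableFrom D v u = Path D u v

reachable-wellFounded : ∀ {D : Digraph} → Acyclic D → WellFounded (ReachableFrom D)
reachable-wellFounded {D} acyclic = spo-wellFounded isSPO
  where
  isSPO : IsStrictPartialOrder _≡_ (ReachableFrom D)
  isSPO = record
    { isEquivalence = isEquivalence
    ; irrefl        = λ { refl p → acyclic _ p }
    ; trans         = λ p q → q ++ₚ p
    ; <-resp-≈      = resp₂ (ReachableFrom D)
    }

IsSinkIn : (D : Digraph) → Fin (n D) → List (Fin (n D)) → Set
IsSinkIn D s L = ∀ {u} → u ∈ L → ¬ D ⟶[ s ] u

-- Every nonempty list of vertices of an acyclic digraph contains a sink of itself: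
-- follow arcs inside L; by well-foundedness of reachability this stops.
sink-exists : ∀ {D : Digraph} → Acyclic D → (L : List (Fin (n D))) → ∀ {x} → x ∈ L →
              ∃[ s ] (s ∈ L × IsSinkIn D s L)
sink-exists {D} acyclic L x∈L = search (reachable-wellFounded acyclic _) x∈L
  where
  search : ∀ {x} → Acc (ReachableFrom D) x → x ∈ L → ∃[ s ] (s ∈ L × IsSinkIn D s L)
  search {x} (acc further) x∈L with Any.any? (λ y → arc D x y Bool.≟ true) L
  ... | no  noArc = x , x∈L , λ y∈L x→y → noArc (lose y∈L x→y)
  ... | yes someArc with find someArc
  ...   | y , y∈L , x→y = search (further (step x→y)) y∈L

-- Sources are sinks of the reversed digraph, which is again acyclic.
reverse : Digraph → Digraph
reverse D = record { n = n D ; arc = λ u v → arc D v u }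

reverse-path : ∀ {D : Digraph} {u v} → Path (reverse D) u v → Path D v u
reverse-path (step v→u)  = step v→u
reverse-path (x→u ∷ₚ p)  = reverse-path p ++ₚ step x→u

reverse-acyclic : ∀ {D : Digraph} → Acyclic D → Acyclic (reverse D)
reverse-acyclic acyclic u p = acyclic u (reverse-path p)

rank⇒acyclic : ∀ {D : Digraph} (rank : Fin (n D) → ℕ) →
               (∀ {u v} → D ⟶[ u ] v → rank u < rank v) → Acyclic D
rank⇒acyclic {D} rank increasing u p = <-irrefl refl (along p)
  where
  along : ∀ {x y} → Path D x y → rank x < rank y
  along (step x→y)  = increasing x→y
  along (x→z ∷ₚ q)  = <-trans (increasing x→z) (along q)

subClique : ∀ {D : Digraph} {K K′} → IsPClique D K → Unique K′ → (∀ {u} → u ∈ K′ → u ∈ K) →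
            IsPClique D K′
subClique (_ , adjacent) unique′ K′⊆K = unique′ , λ u∈ v∈ u≢v → adjacent (K′⊆K u∈) (K′⊆K v∈) u≢v

module CliqueBounds (D : Digraph) (acyclic : Acyclic D) where

  _⟶_ : Fin (n D) → Fin (n D) → Set
  u ⟶ v = D ⟶[ u ] v

  -- A member u of a clique with sink s is an in-neighbour of s or shares an
  -- out-neighbour with s, because s ⟶ u is excluded.
  data Attached (s u : Fin (n D)) : Set where
    into  : u ⟶ s → Attached s u
    share : ∀ {w} → s ⟶ w → u ⟶ w → Attached s u

  attached : ∀ {s u} → PAdj D s u → ¬ s ⟶ u → Attached s u
  attached (_ , inj₁ s→u)                     ¬s→u = ⊥-elim (¬s→u s→u)
  attached (_ , inj₂ (inj₁ u→s))              _    = into u→s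
  attached (_ , inj₂ (inj₂ (w , s→w , u→w))) _    = share s→w u→w

  attachedInClique : ∀ {s O u} → IsPClique D (s ∷ O) → IsSinkIn D s O → u ∈ O → Attached s u
  attachedInClique (s∉O ∷ _ , adjacent) sink u∈O =
    attached (adjacent (here refl) (there u∈O) (All.lookup s∉O u∈O)) (sink u∈O)

  record SinkFirst (K : List (Fin (n D))) : Set where
    field
      sink   : Fin (n D)
      others : List (Fin (n D))
      clique : IsPClique D (sink ∷ others)
      isSink : IsSinkIn D sink others
      size   : length K ≤ suc (length others)

  -- Take a sink s of K and the members of K different from s; since K is
  -- duplicate-free, only one member (s itself) is dropped.
  sinkFirst : ∀ {K x} → IsPClique D K → x ∈ K → SinkFirst K
  sinkFirst {K} isClique@(unique , _) x∈K with sink-exists acyclic K x∈K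
  ... | s , s∈K , s-sink = record
    { sink   = s
    ; others = O
    ; clique = subClique isClique
                 (All.tabulate (λ u∈O → ≢-sym (proj₂ (member u∈O))) ∷ Unique.filter⁺ differs unique)
                 λ { (here refl) → s∈K ; (there u∈O) → proj₁ (member u∈O) }
    ; isSink = λ u∈O → s-sink (proj₁ (member u∈O))
    ; size   = ≤-trans (≤-reflexive (length-filter-split (_≟ s) K)) (+-mono-≤ atMostOne ≤-refl)
    }
    where
    differs : ∀ u → Dec (u ≢ s)
    differs u = ¬? (u ≟ s)
    O : List (Fin (n D))
    O = filter differs K
    member : ∀ {u} → u ∈ O → u ∈ K × u ≢ s
    member = ∈-filter⁻ differs {xs = K}
    atMostOne : length (filter (_≟ s) K) ≤ 1
    atMostOne = ≤-trans
      (count-≤ _≡_ (λ p q → trans p (sym q)) ⁅ s ⁆ _ (Unique.filter⁺ (_≟ s) unique)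
        (All.tabulate (λ u∈ → s , x∈⁅x⁆ s , proj₂ (∈-filter⁻ (_≟ s) {xs = K} u∈))))
      (≤-reflexive (∣⁅x⁆∣≡1 s))

  boundViaSink : ∀ k → (∀ s O → IsPClique D (s ∷ O) → IsSinkIn D s O → length O ≤ k) →
                 CliqueNumberLE D (suc k)
  boundViaSink k bound-others []          _        = z≤n
  boundViaSink k bound-others K@(_ ∷ _) isClique =
    ≤-trans size (s≤s (bound-others sink others clique isSink))
    where open SinkFirst (sinkFirst isClique (here refl))

  -- Bound for every j: a sink s of a clique has at most two in-neighbours in it, and
  -- the remaining members inject into the out-neighbourhood of s, since a shared
  -- out-neighbour w of s has room for only one further in-neighbour.
  generalBound : ∀ j → (∀ v → indeg D v ≤ 2) → (∀ v → outdeg D v ≤ j) →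
                 CliqueNumberLE D (suc (2 + j))
  generalBound j indeg≤2 outdeg≤j = boundViaSink (2 + j) others≤
    where
    others≤ : ∀ s O → IsPClique D (s ∷ O) → IsSinkIn D s O → length O ≤ 2 + j
    others≤ s O isClique@(s∉O ∷ uniqueO , _) sink =
      ≤-trans (≤-reflexive (length-filter-split into? O)) (+-mono-≤ intoCount shareCount)
      where
      into? : ∀ u → Dec (u ⟶ s)
      into? u = arc D u s Bool.≟ true
      notInto? : ∀ u → Dec (¬ u ⟶ s)
      notInto? u = ¬? (into? u)

      intoCount : length (filter into? O) ≤ 2
      intoCount = ≤-trans
        (in-neighbours≤indeg D s _ (Unique.filter⁺ into? uniqueO)
          (All.tabulate (λ u∈ → proj₂ (∈-filter⁻ into? {xs = O} u∈))))
        (indeg≤2 s)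

      Shares : Fin (n D) → Fin (n D) → Set
      Shares u w = u ⟶ w × s ⟶ w × u ≢ s

      sharesFunctional : ∀ {u u′ w} → Shares u w → Shares u′ w → u ≡ u′
      sharesFunctional {u} {u′} (u→w , s→w , u≢s) (u′→w , _ , u′≢s) with u ≟ u′
      ... | yes u≡u′ = u≡u′
      ... | no  u≢u′ = ⊥-elim (noThreeIn D (indeg≤2 _) (≢-sym u≢s) (≢-sym u′≢s) u≢u′ s→w u→w u′→w)

      witness : ∀ {u} → u ∈ filter notInto? O → ∃[ w ] (w ∈ₛ outNbhd D s × Shares u w)
      witness u∈ with ∈-filter⁻ notInto? {xs = O} u∈
      ... | u∈O , ¬u→s with attachedInClique isClique sink u∈O
      ...   | into u→s          = ⊥-elim (¬u→s u→s)
      ...   | share {w} s→w u→w =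
        w , ∈ₛ-tabulate⁺ (arc D s) s→w , u→w , s→w , ≢-sym (All.lookup s∉O u∈O)

      shareCount : length (filter notInto? O) ≤ j
      shareCount = ≤-trans
        (count-≤ Shares sharesFunctional (outNbhd D s) _ (Unique.filter⁺ notInto? uniqueO)
                 (All.tabulate witness))
        (outdeg≤j s)

  module OutdegreeOne (indeg≤2 : ∀ v → indeg D v ≤ 2) (outdeg≤1 : ∀ v → outdeg D v ≤ 1) where

    -- Two members sharing out-neighbours with s share the same one (s has only one),
    -- which then has three in-neighbours.
    twoShare : ∀ {s x y w w′} → s ≢ x → s ≢ y → x ≢ y →
               s ⟶ w → x ⟶ w → s ⟶ w′ → y ⟶ w′ → ⊥
    twoShare {w = w} {w′} s≢x s≢y x≢y s→w x→w s→w′ y→w′ with w ≟ w′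
    ... | yes refl = noThreeIn D (indeg≤2 w) s≢x s≢y x≢y s→w x→w y→w′
    ... | no  w≢w′ = noTwoOut D (outdeg≤1 _) w≢w′ s→w s→w′

    -- If a, b ⟶ s and c shares w with s, then a (whose only out-neighbour is s) is
    -- not adjacent to c.
    twoIntoOneShare : ∀ {s a b c w} → a ≢ b → a ≢ c → b ≢ c → s ≢ c → ¬ s ⟶ a →
                      a ⟶ s → b ⟶ s → s ⟶ w → c ⟶ w → PAdj D a c → ⊥
    twoIntoOneShare _ _ _ s≢c _ a→s _ _ _ (_ , inj₁ a→c) = noTwoOut D (outdeg≤1 _) s≢c a→s a→c
    twoIntoOneShare _ _ _ _ ¬s→a _ _ s→w c→w (_ , inj₂ (inj₁ c→a)) =
      noTwoOut D (outdeg≤1 _) (λ { refl → ¬s→a s→w }) c→w c→a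
    twoIntoOneShare {s} a≢b a≢c b≢c _ _ a→s b→s _ _ (_ , inj₂ (inj₂ (x , a→x , c→x))) with x ≟ s
    ... | yes refl = noThreeIn D (indeg≤2 s) a≢b a≢c b≢c a→s b→s c→x
    ... | no  x≢s  = noTwoOut D (outdeg≤1 _) (≢-sym x≢s) a→s a→x

    -- A 4-clique with sink s: three into s overload s, two sharing members overload
    -- s or their shared vertex, and otherwise twoIntoOneShare applies.
    noFour : ∀ {s a b c} → IsPClique D (s ∷ a ∷ b ∷ c ∷ []) → IsSinkIn D s (a ∷ b ∷ c ∷ []) → ⊥
    noFour isClique@((s≢a ∷ s≢b ∷ s≢c ∷ []) ∷ (a≢b ∷ a≢c ∷ []) ∷ (b≢c ∷ []) ∷ [] ∷ [] , adjacent) sink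
      with attachedInClique isClique sink (here refl)
         | attachedInClique isClique sink (there (here refl))
         | attachedInClique isClique sink (there (there (here refl)))
    ... | into a→s | into b→s | into c→s = noThreeIn D (indeg≤2 _) a≢b a≢c b≢c a→s b→s c→s
    ... | into a→s | into b→s | share s→w c→w =
      twoIntoOneShare a≢b a≢c b≢c s≢c (sink (here refl)) a→s b→s s→w c→w
        (adjacent (there (here refl)) (there (there (there (here refl)))) a≢c)
    ... | into a→s | share s→w b→w | into c→s =
      twoIntoOneShare a≢c a≢b (≢-sym b≢c) s≢b (sink (here refl)) a→s c→s s→w b→w
        (adjacent (there (here refl)) (there (there (here refl))) a≢b)
    ... | share s→w a→w | into b→s | into c→s =
      twoIntoOneShare b≢c (≢-sym a≢b) (≢-sym a≢c) s≢a (sink (there (here refl))) b→s c→s s→w a→w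
        (adjacent (there (there (here refl))) (there (here refl)) (≢-sym a≢b))
    ... | into _ | share s→w b→w | share s→w′ c→w′ = twoShare s≢b s≢c b≢c s→w b→w s→w′ c→w′
    ... | share s→w a→w | into _ | share s→w′ c→w′ = twoShare s≢a s≢c a≢c s→w a→w s→w′ c→w′
    ... | share s→w a→w | share s→w′ b→w′ | _      = twoShare s≢a s≢b a≢b s→w a→w s→w′ b→w′

    cliqueBound : CliqueNumberLE D 3
    cliqueBound = boundViaSink 2 others≤2
      where
      others≤2 : ∀ s O → IsPClique D (s ∷ O) → IsSinkIn D s O → length O ≤ 2
      others≤2 s []          _ _ = z≤n
      others≤2 s (_ ∷ [])     _ _ = s≤s z≤n
      others≤2 s (_ ∷ _ ∷ []) _ _ = s≤s (s≤s z≤n)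
      others≤2 s (a ∷ b ∷ c ∷ rest) isClique@(unique , _) sink =
        ⊥-elim (noFour (subClique isClique (Unique.take⁺ 4 unique) ∈-++⁺ˡ)
                       (λ u∈ → sink (∈-++⁺ˡ u∈)))

  module OutdegreeTwo (indeg≤2 : ∀ v → indeg D v ≤ 2) (outdeg≤2 : ∀ v → outdeg D v ≤ 2) where

    -- Three members cannot all share out-neighbours with the sink s: two of the shared
    -- vertices coincide (three in-neighbours) or s has three out-neighbours.
    threeShare : ∀ {s x y z w w′ w″} → s ≢ x → s ≢ y → s ≢ z → x ≢ y → x ≢ z → y ≢ z →
                 s ⟶ w → x ⟶ w → s ⟶ w′ → y ⟶ w′ → s ⟶ w″ → z ⟶ w″ → ⊥
    threeShare {w = w} {w′} {w″} s≢x s≢y s≢z x≢y x≢z y≢z s→w x→w s→w′ y→w′ s→w″ z→w″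
      with w ≟ w′ | w ≟ w″ | w′ ≟ w″
    ... | yes refl | _        | _        = noThreeIn D (indeg≤2 w) s≢x s≢y x≢y s→w x→w y→w′
    ... | no _     | yes refl | _        = noThreeIn D (indeg≤2 w) s≢x s≢z x≢z s→w x→w z→w″
    ... | no _     | no _     | yes refl = noThreeIn D (indeg≤2 w′) s≢y s≢z y≢z s→w′ y→w′ z→w″
    ... | no w≢w′  | no w≢w″  | no w′≢w″ = noThreeOut D (outdeg≤2 _) w≢w′ w≢w″ w′≢w″ s→w s→w′ s→w″

    _≼_ : Fin (n D) → Fin (n D) → Set
    x ≼ o = x ≡ o ⊎ x ⟶ o

    -- Dually to Attached, a member x of a clique with source c (x ⟶ c excluded)
    -- reaches some out-neighbour of c in at most one step.
    Reaches : Fin (n D) → Fin (n D) → Set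
    Reaches c x = ∃[ o ] (c ⟶ o × x ≼ o)

    reaches : ∀ {c x} → PAdj D c x → ¬ x ⟶ c → Reaches c x
    reaches (_ , inj₁ c→x)                     _    = _ , c→x , inj₁ refl
    reaches (_ , inj₂ (inj₁ x→c))              ¬x→c = ⊥-elim (¬x→c x→c)
    reaches (_ , inj₂ (inj₂ (o , c→o , x→o))) _    = o , c→o , inj₂ x→o

    -- Besides c ⟶ o, at most one of three distinct x ≼ o is an in-neighbour of o.
    threeReaching : ∀ {c o x y z} → c ≢ x → c ≢ y → c ≢ z → x ≢ y → x ≢ z → y ≢ z →
                    c ⟶ o → x ≼ o → y ≼ o → z ≼ o → ⊥
    threeReaching _ _ _ x≢y _ _ _ (inj₁ refl) (inj₁ refl) _ = x≢y refl
    threeReaching _ _ _ _ x≢z _ _ (inj₁ refl) _ (inj₁ refl) = x≢z refl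
    threeReaching _ _ _ _ _ y≢z _ _ (inj₁ refl) (inj₁ refl) = y≢z refl
    threeReaching c≢x c≢y _ x≢y _ _ c→o (inj₂ x→o) (inj₂ y→o) _ =
      noThreeIn D (indeg≤2 _) c≢x c≢y x≢y c→o x→o y→o
    threeReaching c≢x _ c≢z _ x≢z _ c→o (inj₂ x→o) _ (inj₂ z→o) =
      noThreeIn D (indeg≤2 _) c≢x c≢z x≢z c→o x→o z→o
    threeReaching _ c≢y c≢z _ _ y≢z c→o _ (inj₂ y→o) (inj₂ z→o) =
      noThreeIn D (indeg≤2 _) c≢y c≢z y≢z c→o y→o z→o

    outsideSink : ∀ {s w x} → s ⟶ w → ¬ s ⟶ x → w ≢ x
    outsideSink s→w ¬s→x refl = ¬s→x s→w

    -- If s and c share w, then w is not reached by a further member x outside the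
    -- out-neighbourhood of s: w would get the third in-neighbour x.
    avoidShared : ∀ {s c w x o} → s ≢ c → s ≢ x → c ≢ x → ¬ s ⟶ x → s ⟶ w → c ⟶ w → x ≼ o → w ≢ o
    avoidShared _   _   _   ¬s→x s→w _   (inj₁ refl) refl = ¬s→x s→w
    avoidShared s≢c s≢x c≢x _    s→w c→w (inj₂ x→o)  refl =
      noThreeIn D (indeg≤2 _) s≢c s≢x c≢x s→w c→w x→o

    avoidSink : ∀ {s a b x o} → s ≢ x → a ≢ b → a ≢ x → b ≢ x → a ⟶ s → b ⟶ s → x ≼ o → s ≢ o
    avoidSink s≢x _   _   _   _   _   (inj₁ refl) refl = s≢x refl
    avoidSink _   a≢b a≢x b≢x a→s b→s (inj₂ x→o)  refl =
      noThreeIn D (indeg≤2 _) a≢b a≢x b≢x a→s b→s x→o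

    -- A source c of the clique that shares w with the sink s: the other three members
    -- reach out-neighbours of c other than w, i.e. all reach the single remaining one.
    sharingSource : ∀ {s c w x y z} → s ≢ c → s ≢ x → s ≢ y → s ≢ z →
                    c ≢ x → c ≢ y → c ≢ z → x ≢ y → x ≢ z → y ≢ z →
                    ¬ s ⟶ x → ¬ s ⟶ y → ¬ s ⟶ z → s ⟶ w → c ⟶ w →
                    Reaches c x → Reaches c y → Reaches c z → ⊥
    sharingSource s≢c s≢x s≢y s≢z c≢x c≢y c≢z x≢y x≢z y≢z ¬s→x ¬s→y ¬s→z s→w c→w
                  (o₁ , c→o₁ , x≼o₁) (o₂ , c→o₂ , y≼o₂) (o₃ , c→o₃ , z≼o₃) with o₁ ≟ o₂ | o₁ ≟ o₃
    ... | yes refl | yes refl = threeReaching c≢x c≢y c≢z x≢y x≢z y≢z c→o₁ x≼o₁ y≼o₂ z≼o₃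
    ... | no o₁≢o₂ | _        = noThreeOut D (outdeg≤2 _)
      (avoidShared s≢c s≢x c≢x ¬s→x s→w c→w x≼o₁) (avoidShared s≢c s≢y c≢y ¬s→y s→w c→w y≼o₂) o₁≢o₂
      c→w c→o₁ c→o₂
    ... | _        | no o₁≢o₃ = noThreeOut D (outdeg≤2 _)
      (avoidShared s≢c s≢x c≢x ¬s→x s→w c→w x≼o₁) (avoidShared s≢c s≢z c≢z ¬s→z s→w c→w z≼o₃) o₁≢o₃
      c→w c→o₁ c→o₃

    notAdjacentToBoth : ∀ {s a b c d w} → s ≢ b → s ≢ d → a ≢ b → a ≢ c → a ≢ d → b ≢ c → b ≢ d →
                        ¬ s ⟶ b → ¬ s ⟶ c → a ⟶ c → d ⟶ c → a ⟶ s → b ⟶ s → s ⟶ w → d ⟶ w →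
                        PAdj D b d → PAdj D b c → ⊥
    notAdjacentToBoth {s} {a} {b} {c} {d} {w}
      s≢b s≢d a≢b a≢c a≢d b≢c b≢d ¬s→b ¬s→c a→c d→c a→s b→s s→w d→w = viaBD
      where
      -- after b ⟶ d, adjacency of b and c closes a cycle or overloads c, s or b
      bcAfterBD : b ⟶ d → PAdj D b c → ⊥
      bcAfterBD b→d (_ , inj₁ b→c) = noThreeIn D (indeg≤2 c) a≢d a≢b (≢-sym b≢d) a→c d→c b→c
      bcAfterBD b→d (_ , inj₂ (inj₁ c→b)) = acyclic b (b→d ∷ₚ (d→c ∷ₚ step c→b))
      bcAfterBD b→d (_ , inj₂ (inj₂ (x , b→x , c→x))) with x ≟ s | x ≟ d
      ... | yes refl | _        = noThreeIn D (indeg≤2 s) a≢b a≢c b≢c a→s b→s c→x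
      ... | no _     | yes refl = acyclic c (c→x ∷ₚ step d→c)
      ... | no x≢s   | no x≢d   =
        noThreeOut D (outdeg≤2 b) s≢d (≢-sym x≢s) (≢-sym x≢d) b→s b→d b→x

      viaBD : PAdj D b d → PAdj D b c → ⊥
      viaBD (_ , inj₁ b→d) b~c = bcAfterBD b→d b~c
      viaBD (_ , inj₂ (inj₁ d→b)) _ =
        noThreeOut D (outdeg≤2 d) (outsideSink s→w ¬s→c) (outsideSink s→w ¬s→b) (≢-sym b≢c) d→w d→c d→b
      viaBD (_ , inj₂ (inj₂ (x , b→x , d→x))) _ with x ≟ w | x ≟ c
      ... | yes refl | _        = noThreeIn D (indeg≤2 w) s≢d s≢b (≢-sym b≢d) s→w d→w b→x
      ... | no _     | yes refl = noThreeIn D (indeg≤2 c) a≢d a≢b (≢-sym b≢d) a→c d→c b→x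
      ... | no x≢w   | no x≢c   =
        noThreeOut D (outdeg≤2 d) (outsideSink s→w ¬s→c) (≢-sym x≢w) (≢-sym x≢c) d→w d→c d→x

    -- A source a of the clique with a, b ⟶ s, where c and d share out-neighbours with s:
    -- c and d reach the single out-neighbour o ≠ s of a, which overloads o or yields
    -- the configuration of notAdjacentToBoth.
    intoSource : ∀ {s a b c d w₁ w₂} → s ≢ b → s ≢ c → s ≢ d →
                 a ≢ b → a ≢ c → a ≢ d → b ≢ c → b ≢ d → c ≢ d →
                 ¬ s ⟶ b → ¬ s ⟶ c → ¬ s ⟶ d →
                 a ⟶ s → b ⟶ s → s ⟶ w₁ → c ⟶ w₁ → s ⟶ w₂ → d ⟶ w₂ →
                 Reaches a c → Reaches a d → PAdj D b d → PAdj D b c → ⊥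
    intoSource {s} {a} {b} {c} {d} s≢b s≢c s≢d a≢b a≢c a≢d b≢c b≢d c≢d ¬s→b ¬s→c ¬s→d
               a→s b→s s→w₁ c→w₁ s→w₂ d→w₂ (o₁ , a→o₁ , c≼o₁) (o₂ , a→o₂ , d≼o₂) b~d b~c
      with o₁ ≟ o₂
    ... | no o₁≢o₂ = noThreeOut D (outdeg≤2 a)
      (avoidSink s≢c a≢b a≢c b≢c a→s b→s c≼o₁) (avoidSink s≢d a≢b a≢d b≢d a→s b→s d≼o₂) o₁≢o₂
      a→s a→o₁ a→o₂
    ... | yes refl = bothReach c≼o₁ d≼o₂
      where
      bothReach : c ≼ o₁ → d ≼ o₁ → ⊥
      bothReach (inj₁ refl) (inj₁ refl) = c≢d refl
      bothReach (inj₂ c→o) (inj₂ d→o)   = noThreeIn D (indeg≤2 _) a≢c a≢d c≢d a→o₁ c→o d→o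
      bothReach (inj₁ refl) (inj₂ d→o)  =
        notAdjacentToBoth s≢b s≢d a≢b a≢c a≢d b≢c b≢d ¬s→b ¬s→c a→o₁ d→o a→s b→s s→w₂ d→w₂ b~d b~c
      bothReach (inj₂ c→o) (inj₁ refl)  =
        notAdjacentToBoth s≢b s≢c a≢b a≢d a≢c b≢d b≢c ¬s→b ¬s→d a→o₁ c→o a→s b→s s→w₁ c→w₁ b~c b~d

    module _ {s : Fin (n D)} {K : List (Fin (n D))}
             (adj : ∀ {u v} → u ∈ K → v ∈ K → u ≢ v → PAdj D u v)
             (sink : ∀ {u} → u ∈ K → ¬ s ⟶ u) where

      -- The members s, a, b, c, d contain a source; it is not s (as a ⟶ s),
      -- and each other choice is excluded by intoSource or sharingSource.
      twoIntoTwoShare : ∀ {a b c d w₁ w₂} → a ∈ K → b ∈ K → c ∈ K → d ∈ K →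
                        s ≢ a → s ≢ b → s ≢ c → s ≢ d →
                        a ≢ b → a ≢ c → a ≢ d → b ≢ c → b ≢ d → c ≢ d →
                        a ⟶ s → b ⟶ s → s ⟶ w₁ → c ⟶ w₁ → s ⟶ w₂ → d ⟶ w₂ → ⊥
      twoIntoTwoShare {a} {b} {c} {d} ∈a ∈b ∈c ∈d s≢a s≢b s≢c s≢d a≢b a≢c a≢d b≢c b≢d c≢d
                      a→s b→s s→w₁ c→w₁ s→w₂ d→w₂
        with sink-exists (reverse-acyclic acyclic) (s ∷ a ∷ b ∷ c ∷ d ∷ []) (here refl)
      ... | _ , here refl , source = source (there (here refl)) a→s
      ... | _ , there (here refl) , source =
        intoSource s≢b s≢c s≢d a≢b a≢c a≢d b≢c b≢d c≢d (sink ∈b) (sink ∈c) (sink ∈d)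
          a→s b→s s→w₁ c→w₁ s→w₂ d→w₂
          (reaches (adj ∈a ∈c a≢c) (source (there (there (there (here refl))))))
          (reaches (adj ∈a ∈d a≢d) (source (there (there (there (there (here refl)))))))
          (adj ∈b ∈d b≢d) (adj ∈b ∈c b≢c)
      ... | _ , there (there (here refl)) , source =
        intoSource s≢a s≢c s≢d (≢-sym a≢b) b≢c b≢d a≢c a≢d c≢d (sink ∈a) (sink ∈c) (sink ∈d)
          b→s a→s s→w₁ c→w₁ s→w₂ d→w₂
          (reaches (adj ∈b ∈c b≢c) (source (there (there (there (here refl))))))
          (reaches (adj ∈b ∈d b≢d) (source (there (there (there (there (here refl)))))))
          (adj ∈a ∈d a≢d) (adj ∈a ∈c a≢c)
      ... | _ , there (there (there (here refl))) , source =
        sharingSource s≢c s≢a s≢b s≢d (≢-sym a≢c) (≢-sym b≢c) c≢d a≢b a≢d b≢d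
          (sink ∈a) (sink ∈b) (sink ∈d) s→w₁ c→w₁
          (reaches (adj ∈c ∈a (≢-sym a≢c)) (source (there (here refl))))
          (reaches (adj ∈c ∈b (≢-sym b≢c)) (source (there (there (here refl)))))
          (reaches (adj ∈c ∈d c≢d) (source (there (there (there (there (here refl)))))))
      ... | _ , there (there (there (there (here refl)))) , source =
        sharingSource s≢d s≢a s≢b s≢c (≢-sym a≢d) (≢-sym b≢d) (≢-sym c≢d) a≢b a≢c b≢c
          (sink ∈a) (sink ∈b) (sink ∈c) s→w₂ d→w₂
          (reaches (adj ∈d ∈a (≢-sym a≢d)) (source (there (here refl))))
          (reaches (adj ∈d ∈b (≢-sym b≢d)) (source (there (there (here refl)))))
          (reaches (adj ∈d ∈c (≢-sym c≢d)) (source (there (there (there (here refl))))))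

    -- Of the four members other than the sink, at most two point to s and at most
    -- two share with s; the remaining split 2 + 2 is the decisive configuration.
    noFive : ∀ {s a b c d} → IsPClique D (s ∷ a ∷ b ∷ c ∷ d ∷ []) →
             IsSinkIn D s (a ∷ b ∷ c ∷ d ∷ []) → ⊥
    noFive {s} {a} {b} {c} {d}
      isClique@((s≢a ∷ s≢b ∷ s≢c ∷ s≢d ∷ []) ∷ (a≢b ∷ a≢c ∷ a≢d ∷ []) ∷ (b≢c ∷ b≢d ∷ []) ∷ (c≢d ∷ []) ∷ []
                ∷ [] , _)
      sink = classify (kind (here refl)) (kind (there (here refl))) (kind (there (there (here refl))))
                      (kind (there (there (there (here refl)))))
      where
      kind : ∀ {u} → u ∈ a ∷ b ∷ c ∷ d ∷ [] → Attached s u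
      kind = attachedInClique isClique sink

      sinkK : ∀ {u} → u ∈ s ∷ a ∷ b ∷ c ∷ d ∷ [] → ¬ s ⟶ u
      sinkK (here refl) s→s = acyclic s (step s→s)
      sinkK (there u∈)      = sink u∈

      ∈a : a ∈ s ∷ a ∷ b ∷ c ∷ d ∷ []
      ∈a = there (here refl)
      ∈b : b ∈ s ∷ a ∷ b ∷ c ∷ d ∷ []
      ∈b = there (there (here refl))
      ∈c : c ∈ s ∷ a ∷ b ∷ c ∷ d ∷ []
      ∈c = there (there (there (here refl)))
      ∈d : d ∈ s ∷ a ∷ b ∷ c ∷ d ∷ []
      ∈d = there (there (there (there (here refl))))

      classify : Attached s a → Attached s b → Attached s c → Attached s d → ⊥
      classify (into a→s) (into b→s) (into c→s) _ = noThreeIn D (indeg≤2 s) a≢b a≢c b≢c a→s b→s c→s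
      classify (into a→s) (into b→s) _ (into d→s) = noThreeIn D (indeg≤2 s) a≢b a≢d b≢d a→s b→s d→s
      classify (into a→s) _ (into c→s) (into d→s) = noThreeIn D (indeg≤2 s) a≢c a≢d c≢d a→s c→s d→s
      classify _ (into b→s) (into c→s) (into d→s) = noThreeIn D (indeg≤2 s) b≢c b≢d c≢d b→s c→s d→s
      classify (share p a→w) (share q b→w′) (share r c→w″) _ =
        threeShare s≢a s≢b s≢c a≢b a≢c b≢c p a→w q b→w′ r c→w″
      classify (share p a→w) (share q b→w′) _ (share r d→w″) =
        threeShare s≢a s≢b s≢d a≢b a≢d b≢d p a→w q b→w′ r d→w″
      classify (share p a→w) _ (share q c→w′) (share r d→w″) =
        threeShare s≢a s≢c s≢d a≢c a≢d c≢d p a→w q c→w′ r d→w″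
      classify _ (share p b→w) (share q c→w′) (share r d→w″) =
        threeShare s≢b s≢c s≢d b≢c b≢d c≢d p b→w q c→w′ r d→w″
      classify (into a→s) (into b→s) (share p c→w) (share q d→w′) =
        twoIntoTwoShare (proj₂ isClique) sinkK ∈a ∈b ∈c ∈d
          s≢a s≢b s≢c s≢d
          a≢b a≢c a≢d b≢c b≢d c≢d
          a→s b→s p c→w q d→w′
      classify (into a→s) (share p b→w) (into c→s) (share q d→w′) =
        twoIntoTwoShare (proj₂ isClique) sinkK ∈a ∈c ∈b ∈d
          s≢a s≢c s≢b s≢d
          a≢c a≢b a≢d (≢-sym b≢c) c≢d b≢d
          a→s c→s p b→w q d→w′
      classify (into a→s) (share p b→w) (share q c→w′) (into d→s) =
        twoIntoTwoShare (proj₂ isClique) sinkK ∈a ∈d ∈b ∈c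
          s≢a s≢d s≢b s≢c
          a≢d a≢b a≢c (≢-sym b≢d) (≢-sym c≢d) b≢c
          a→s d→s p b→w q c→w′
      classify (share p a→w) (into b→s) (into c→s) (share q d→w′) =
        twoIntoTwoShare (proj₂ isClique) sinkK ∈b ∈c ∈a ∈d
          s≢b s≢c s≢a s≢d
          b≢c (≢-sym a≢b) b≢d (≢-sym a≢c) c≢d a≢d
          b→s c→s p a→w q d→w′
      classify (share p a→w) (into b→s) (share q c→w′) (into d→s) =
        twoIntoTwoShare (proj₂ isClique) sinkK ∈b ∈d ∈a ∈c
          s≢b s≢d s≢a s≢c
          b≢d (≢-sym a≢b) b≢c (≢-sym a≢d) (≢-sym c≢d) a≢c
          b→s d→s p a→w q c→w′
      classify (share p a→w) (share q b→w′) (into c→s) (into d→s) =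
        twoIntoTwoShare (proj₂ isClique) sinkK ∈c ∈d ∈a ∈b
          s≢c s≢d s≢a s≢b
          c≢d (≢-sym a≢c) (≢-sym b≢c) (≢-sym a≢d) (≢-sym b≢d) a≢b
          c→s d→s p a→w q b→w′

    cliqueBound : CliqueNumberLE D 4
    cliqueBound = boundViaSink 3 others≤3
      where
      others≤3 : ∀ s O → IsPClique D (s ∷ O) → IsSinkIn D s O → length O ≤ 3
      others≤3 s []              _ _ = z≤n
      others≤3 s (_ ∷ [])         _ _ = s≤s z≤n
      others≤3 s (_ ∷ _ ∷ [])     _ _ = s≤s (s≤s z≤n)
      others≤3 s (_ ∷ _ ∷ _ ∷ []) _ _ = s≤s (s≤s (s≤s z≤n))
      others≤3 s (a ∷ b ∷ c ∷ d ∷ rest) isClique@(unique , _) sink =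
        ⊥-elim (noFive (subClique isClique (Unique.take⁺ 5 unique) ∈-++⁺ˡ)
                       (λ u∈ → sink (∈-++⁺ˡ u∈)))

upperBound : ∀ j (D : Digraph) → Is2j (suc j) D → CliqueNumberLE D (bound (suc j))
upperBound zero D (_ , acyclic , indeg≤2 , outdeg≤1) = OutdegreeOne.cliqueBound indeg≤2 outdeg≤1
  where open CliqueBounds D acyclic
upperBound (suc zero) D (_ , acyclic , indeg≤2 , outdeg≤2) = OutdegreeTwo.cliqueBound indeg≤2 outdeg≤2
  where open CliqueBounds D acyclic
upperBound (suc (suc j)) D (_ , acyclic , indeg≤2 , outdeg≤j) =
  subst (CliqueNumberLE D) (+-comm 3 (3 + j)) (generalBound (3 + j) indeg≤2 outdeg≤j)
  where open CliqueBounds D acyclic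

fromArcs : (N : ℕ) → List (Fin N × Fin N) → Digraph
fromArcs N arcs = record { n = N ; arc = λ u v → does (Any.any? (≡-dec _≟_ _≟_ (u , v)) arcs) }

PAdj? : ∀ (D : Digraph) u v → Dec (PAdj D u v)
PAdj? D u v = ¬? (u ≟ v) ×-dec (arc? u v ⊎-dec arc? v u ⊎-dec any? λ w → arc? u w ×-dec arc? v w)
  where
  arc? : ∀ x y → Dec (D ⟶[ x ] y)
  arc? x y = arc D x y Bool.≟ true

isPClique? : ∀ (D : Digraph) xs → Dec (IsPClique D xs)
isPClique? D xs =
  map′ (λ (unique , adjacent) → unique , λ u∈ v∈ → All.lookup (All.lookup adjacent u∈) v∈)
       (λ (unique , adjacent) → unique , All.tabulate λ u∈ → All.tabulate λ v∈ → adjacent u∈ v∈)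
       (allPairs? (λ x y → ¬? (x ≟ y)) xs ×-dec
        All.all? (λ u → All.all? (λ v → ¬? (u ≟ v) →-dec PAdj? D u v) xs) xs)

-- An explicit digraph on Fin N whose arcs all increase the index is acyclic, so being
-- a (2,j) digraph reduces to finitely many checks, discharged by evaluation.
increasing? : ∀ (D : Digraph) → Dec (∀ u v → D ⟶[ u ] v → toℕ u < toℕ v)
increasing? D = all? λ u → all? λ v → (arc D u v Bool.≟ true) →-dec (toℕ u <? toℕ v)

is2j-byEvaluation : ∀ j (D : Digraph) → {True (increasing? D)} →
                    {True (all? λ v → indeg D v ≤? 2)} → {True (all? λ v → outdeg D v ≤? j)} →
                    Is2j j D
is2j-byEvaluation j D {increasing} {indeg≤2} {outdeg≤j} =
  (λ u u→u → acyclic u (step u→u)) , acyclic , toWitness indeg≤2 , toWitness outdeg≤j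
  where
  acyclic : Acyclic D
  acyclic = rank⇒acyclic toℕ (toWitness increasing _ _)

D₁ : Digraph
D₁ = fromArcs 3 ((# 0 , # 2) ∷ (# 1 , # 2) ∷ [])

tight₁ : ∃ λ D → Is2j 1 D × CliqueNumberEq D (bound 1)
tight₁ = D₁ , is2j , upperBound 0 D₁ is2j , K , from-yes (isPClique? D₁ K) , refl
  where
  is2j : Is2j 1 D₁
  is2j = is2j-byEvaluation 1 D₁
  K : List (Fin 3)
  K = # 0 ∷ # 1 ∷ # 2 ∷ []

D₂ : Digraph
D₂ = fromArcs 5 ((# 0 , # 2) ∷ (# 0 , # 3) ∷ (# 1 , # 2) ∷ (# 1 , # 3) ∷
                  (# 2 , # 4) ∷ (# 3 , # 4) ∷ [])

tight₂ : ∃ λ D → Is2j 2 D × CliqueNumberEq D (bound 2)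
tight₂ = D₂ , is2j , upperBound 1 D₂ is2j , K , from-yes (isPClique? D₂ K) , refl
  where
  is2j : Is2j 2 D₂
  is2j = is2j-byEvaluation 2 D₂
  K : List (Fin 5)
  K = # 0 ∷ # 1 ∷ # 2 ∷ # 3 ∷ []

module Relabel {V : Set} {N : ℕ} (enumeration : Fin N ↔ V)
               {_⇒_ : V → V → Set} (_⇒?_ : ∀ x y → Dec (x ⇒ y)) where

  open Inverse enumeration using (to; from; strictlyInverseˡ; strictlyInverseʳ)

  digraph : Digraph
  digraph = record { n = N ; arc = λ u v → does (to u ⇒? to v) }

  arc⁻ : ∀ {u v} → digraph ⟶[ u ] v → to u ⇒ to v
  arc⁻ {u} {v} u→v with to u ⇒? to v
  ... | yes x⇒y = x⇒y

  arc⁺ : ∀ {x y} → x ⇒ y → digraph ⟶[ from x ] from y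
  arc⁺ {x} {y} x⇒y =
    subst₂ (λ x′ y′ → does (x′ ⇒? y′) ≡ true) (sym (strictlyInverseˡ x)) (sym (strictlyInverseˡ y))
           (dec-true (x ⇒? y) x⇒y)

  from-injective : ∀ {x y} → from x ≡ from y → x ≡ y
  from-injective {x} {y} eq = trans (sym (strictlyInverseˡ x)) (trans (cong to eq) (strictlyInverseˡ y))

  acyclic-byRank : (rank : V → ℕ) → (∀ {x y} → x ⇒ y → rank x < rank y) → Acyclic digraph
  acyclic-byRank rank increasing = rank⇒acyclic (λ u → rank (to u)) (λ u→v → increasing (arc⁻ u→v))

  indeg≤ : (candidates : V → List V) → (∀ {x y} → x ⇒ y → x ∈ candidates y) →
           ∀ v → indeg digraph v ≤ length (candidates (to v))
  indeg≤ candidates complete v =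
    ≤-trans (indeg≤length digraph v (map from (candidates (to v))) listed)
            (≤-reflexive (length-map from (candidates (to v))))
    where
    listed : ∀ {u} → digraph ⟶[ u ] v → u ∈ map from (candidates (to v))
    listed {u} u→v = subst (_∈ _) (strictlyInverseʳ u) (∈-map⁺ from (complete (arc⁻ u→v)))

  outdeg≤ : (candidates : V → List V) → (∀ {x y} → x ⇒ y → y ∈ candidates x) →
            ∀ v → outdeg digraph v ≤ length (candidates (to v))
  outdeg≤ candidates complete v =
    ≤-trans (outdeg≤length digraph v (map from (candidates (to v))) listed)
            (≤-reflexive (length-map from (candidates (to v))))
    where
    listed : ∀ {u} → digraph ⟶[ v ] u → u ∈ map from (candidates (to v))
    listed {u} v→u = subst (_∈ _) (strictlyInverseʳ u) (∈-map⁺ from (complete (arc⁻ v→u)))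

  Adjacent : V → V → Set
  Adjacent x y = x ⇒ y ⊎ y ⇒ x ⊎ ∃[ w ] (x ⇒ w × y ⇒ w)

  Adjacent-sym : ∀ {x y} → Adjacent x y → Adjacent y x
  Adjacent-sym (inj₁ x⇒y)                    = inj₂ (inj₁ x⇒y)
  Adjacent-sym (inj₂ (inj₁ y⇒x))             = inj₁ y⇒x
  Adjacent-sym (inj₂ (inj₂ (w , x⇒w , y⇒w))) = inj₂ (inj₂ (w , y⇒w , x⇒w))

  clique : (K : List V) → Unique K → (∀ {x y} → x ∈ K → y ∈ K → x ≢ y → Adjacent x y) →
           IsPClique digraph (map from K)
  clique K unique adjacent = Unique.map⁺ from-injective unique , adjacent′
    where
    arcs : ∀ {x y} → Adjacent x y →
           digraph ⟶[ from x ] from y ⊎ digraph ⟶[ from y ] from x ⊎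
           ∃[ w ] (digraph ⟶[ from x ] w × digraph ⟶[ from y ] w)
    arcs (inj₁ x⇒y)                   = inj₁ (arc⁺ x⇒y)
    arcs (inj₂ (inj₁ y⇒x))            = inj₂ (inj₁ (arc⁺ y⇒x))
    arcs (inj₂ (inj₂ (w , x⇒w , y⇒w))) = inj₂ (inj₂ (from w , arc⁺ x⇒w , arc⁺ y⇒w))

    adjacent′ : ∀ {u v} → u ∈ map from K → v ∈ map from K → u ≢ v → PAdj digraph u v
    adjacent′ u∈ v∈ u≢v with ∈-map⁻ from u∈ | ∈-map⁻ from v∈
    ... | x , x∈K , refl | y , y∈K , refl = u≢v , arcs (adjacent x∈K y∈K λ { refl → u≢v refl })

module Construction (m : ℕ) where

  -- the outdegree bound j = m + 3
  J : ℕ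
  J = suc (suc (suc m))

  -- Three sources, J centres, for each centre c a vertex priv c, and for centres
  -- a < b a vertex mid a b (the vertices mid a b with a ≮ b stay isolated).
  data Vertex : Set where
    src  : Fin 3 → Vertex
    ctr  : Fin J → Vertex
    priv : Fin J → Vertex
    mid  : Fin J → Fin J → Vertex

  -- Centre c is not an out-neighbour of the source missing c; centres 0, 1, 2 miss
  -- different sources, so any two sources have a common centre as out-neighbour.
  missing : Fin J → Fin 3
  missing zero          = zero
  missing (suc zero)    = suc zero
  missing (suc (suc _)) = suc (suc zero)

  -- A source meets each centre directly or through priv c; two centres meet at mid.
  infix 4 _⇒_
  data _⇒_ : Vertex → Vertex → Set where
    src⇒ctr  : ∀ {s c} → s ≢ missing c → src s ⇒ ctr c
    src⇒priv : ∀ {c} → src (missing c) ⇒ priv c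
    ctr⇒priv : ∀ {c} → ctr c ⇒ priv c
    ctr⇒midˡ : ∀ {a b} → a <ᶠ b → ctr a ⇒ mid a b
    ctr⇒midʳ : ∀ {a b} → a <ᶠ b → ctr b ⇒ mid a b

  _⇒?_ : ∀ x y → Dec (x ⇒ y)
  src s ⇒? ctr c  = map′ src⇒ctr (λ { (src⇒ctr s≢) → s≢ }) (¬? (s ≟ missing c))
  src s ⇒? priv c = map′ (λ { refl → src⇒priv }) (λ { src⇒priv → refl }) (s ≟ missing c)
  ctr c ⇒? priv d = map′ (λ { refl → ctr⇒priv }) (λ { ctr⇒priv → refl }) (c ≟ d)
  ctr c ⇒? mid a b with a <ᶠ? b | c ≟ a | c ≟ b
  ... | no a≮b  | _        | _        = no λ { (ctr⇒midˡ a<b) → a≮b a<b ; (ctr⇒midʳ a<b) → a≮b a<b }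
  ... | yes a<b | yes refl | _        = yes (ctr⇒midˡ a<b)
  ... | yes a<b | no _     | yes refl = yes (ctr⇒midʳ a<b)
  ... | yes _   | no c≢a   | no c≢b   = no λ { (ctr⇒midˡ _) → c≢a refl ; (ctr⇒midʳ _) → c≢b refl }
  src _   ⇒? src _   = no λ ()
  src _   ⇒? mid _ _ = no λ ()
  ctr _   ⇒? src _   = no λ ()
  ctr _   ⇒? ctr _   = no λ ()
  priv _  ⇒? _       = no λ ()
  mid _ _ ⇒? _       = no λ ()

  N : ℕ
  N = 3 + (J + (J + J * J))

  vertex↔sum : Vertex ↔ (Fin 3 ⊎ Fin J ⊎ Fin J ⊎ Fin J × Fin J)
  vertex↔sum = mk↔ₛ′ encode decode encode∘decode decode∘encode
    where
    encode : Vertex → Fin 3 ⊎ Fin J ⊎ Fin J ⊎ Fin J × Fin J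
    encode (src s)   = inj₁ s
    encode (ctr c)   = inj₂ (inj₁ c)
    encode (priv c)  = inj₂ (inj₂ (inj₁ c))
    encode (mid a b) = inj₂ (inj₂ (inj₂ (a , b)))
    decode : Fin 3 ⊎ Fin J ⊎ Fin J ⊎ Fin J × Fin J → Vertex
    decode (inj₁ s)                     = src s
    decode (inj₂ (inj₁ c))              = ctr c
    decode (inj₂ (inj₂ (inj₁ c)))       = priv c
    decode (inj₂ (inj₂ (inj₂ (a , b)))) = mid a b
    encode∘decode : ∀ y → encode (decode y) ≡ y
    encode∘decode (inj₁ _)               = refl
    encode∘decode (inj₂ (inj₁ _))        = refl
    encode∘decode (inj₂ (inj₂ (inj₁ _))) = refl
    encode∘decode (inj₂ (inj₂ (inj₂ _))) = refl
    decode∘encode : ∀ x → decode (encode x) ≡ x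
    decode∘encode (src _)   = refl
    decode∘encode (ctr _)   = refl
    decode∘encode (priv _)  = refl
    decode∘encode (mid _ _) = refl

  enumeration : Fin N ↔ Vertex
  enumeration =
    ↔-trans +↔⊎ (↔-trans (↔-refl ⊎-↔ ↔-trans +↔⊎ (↔-refl ⊎-↔ ↔-trans +↔⊎ (↔-refl ⊎-↔ *↔×)))
                         (↔-sym vertex↔sum))

  open Relabel enumeration _⇒?_
  open Inverse enumeration using (to; from)

  rank : Vertex → ℕ
  rank (src _) = 0
  rank (ctr _) = 1
  rank _       = 2

  rank-increasing : ∀ {x y} → x ⇒ y → rank x < rank y
  rank-increasing (src⇒ctr _)  = s≤s z≤n
  rank-increasing src⇒priv     = s≤s z≤n
  rank-increasing ctr⇒priv     = s≤s (s≤s z≤n)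
  rank-increasing (ctr⇒midˡ _) = s≤s (s≤s z≤n)
  rank-increasing (ctr⇒midʳ _) = s≤s (s≤s z≤n)

  listed : ∀ {A : Set} {k} (f : Fin k → A) (i : Fin k) → f i ∈ map f (allFin k)
  listed f i = ∈-map⁺ f (∈-allFin i)

  listedExcept : ∀ {A : Set} {k} (f : Fin (suc k) → A) {i j} → i ≢ j →
                 f j ∈ map (λ t → f (punchIn i t)) (allFin k)
  listedExcept {k = k} f {i} i≢j =
    subst (_∈ map (λ t → f (punchIn i t)) (allFin k)) (cong f (punchIn-punchOut i≢j))
          (listed (λ t → f (punchIn i t)) (punchOut i≢j))

  length-listing : ∀ {A : Set} {k} (f : Fin k → A) → length (map f (allFin k)) ≡ k
  length-listing {k = k} f = trans (length-map f (allFin k)) (length-tabulate id)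

  inCandidates : Vertex → List Vertex
  inCandidates (src _)   = []
  inCandidates (ctr c)   = map (λ t → src (punchIn (missing c) t)) (allFin 2)
  inCandidates (priv c)  = src (missing c) ∷ ctr c ∷ []
  inCandidates (mid a b) = ctr a ∷ ctr b ∷ []

  inCandidates-complete : ∀ {x y} → x ⇒ y → x ∈ inCandidates y
  inCandidates-complete (src⇒ctr s≢) = listedExcept src (≢-sym s≢)
  inCandidates-complete src⇒priv     = here refl
  inCandidates-complete ctr⇒priv     = there (here refl)
  inCandidates-complete (ctr⇒midˡ _) = here refl
  inCandidates-complete (ctr⇒midʳ _) = there (here refl)

  inCandidates-length : ∀ y → length (inCandidates y) ≤ 2
  inCandidates-length (src _)   = z≤n
  inCandidates-length (ctr _)   = ≤-refl
  inCandidates-length (priv _)  = ≤-refl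
  inCandidates-length (mid _ _) = ≤-refl

  viaCentre : Fin 3 → Fin J → Vertex
  viaCentre s c with s ≟ missing c
  ... | yes _ = priv c
  ... | no  _ = ctr c

  viaCentre-ctr : ∀ {s c} → s ≢ missing c → viaCentre s c ≡ ctr c
  viaCentre-ctr {s} {c} s≢ with s ≟ missing c
  ... | yes s≡ = ⊥-elim (s≢ s≡)
  ... | no  _  = refl

  viaCentre-priv : ∀ c → viaCentre (missing c) c ≡ priv c
  viaCentre-priv c with missing c ≟ missing c
  ... | yes _   = refl
  ... | no  m≢m = ⊥-elim (m≢m refl)

  meet : Fin J → Fin J → Vertex
  meet c d with c <ᶠ? d
  ... | yes _ = mid c d
  ... | no  _ = mid d c

  meet-< : ∀ {c d} → c <ᶠ d → meet c d ≡ mid c d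
  meet-< {c} {d} c<d with c <ᶠ? d
  ... | yes _   = refl
  ... | no  c≮d = ⊥-elim (c≮d c<d)

  meet-> : ∀ {c d} → d <ᶠ c → meet c d ≡ mid d c
  meet-> {c} {d} d<c with c <ᶠ? d
  ... | yes c<d = ⊥-elim (<-asym c<d d<c)
  ... | no  _   = refl

  outCandidates : Vertex → List Vertex
  outCandidates (src s) = map (viaCentre s) (allFin J)
  outCandidates (ctr c) = priv c ∷ map (λ t → meet c (punchIn c t)) (allFin (suc (suc m)))
  outCandidates _       = []

  outCandidates-complete : ∀ {x y} → x ⇒ y → y ∈ outCandidates x
  outCandidates-complete (src⇒ctr {s} {c} s≢) =
    subst (_∈ outCandidates (src s)) (viaCentre-ctr s≢) (listed (viaCentre s) c)
  outCandidates-complete (src⇒priv {c}) =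
    subst (_∈ outCandidates (src (missing c))) (viaCentre-priv c) (listed (viaCentre (missing c)) c)
  outCandidates-complete ctr⇒priv = here refl
  outCandidates-complete (ctr⇒midˡ {a} a<b) =
    there (subst (_∈ _) (meet-< a<b) (listedExcept (meet a) (<⇒≢ a<b)))
  outCandidates-complete (ctr⇒midʳ {b = b} a<b) =
    there (subst (_∈ _) (meet-> a<b) (listedExcept (meet b) (≢-sym (<⇒≢ a<b))))

  outCandidates-length : ∀ x → length (outCandidates x) ≤ J
  outCandidates-length (src s)   = ≤-reflexive (length-listing (viaCentre s))
  outCandidates-length (ctr c)   = ≤-reflexive (cong suc (length-listing (λ t → meet c (punchIn c t))))
  outCandidates-length (priv _)  = z≤n
  outCandidates-length (mid _ _) = z≤n

  is2j : Is2j J digraph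
  is2j = (λ u u→u → acyclicD u (step u→u)) , acyclicD ,
         (λ v → ≤-trans (indeg≤ inCandidates inCandidates-complete v) (inCandidates-length (to v))) ,
         (λ v → ≤-trans (outdeg≤ outCandidates outCandidates-complete v) (outCandidates-length (to v)))
    where
    acyclicD : Acyclic digraph
    acyclicD = acyclic-byRank rank rank-increasing

  K : List Vertex
  K = map src (allFin 3) ++ map ctr (allFin J)

  K-unique : Unique K
  K-unique = Unique.++⁺ (Unique.map⁺ {f = src} (λ { refl → refl }) (Unique.allFin⁺ 3))
                        (Unique.map⁺ {f = ctr} (λ { refl → refl }) (Unique.allFin⁺ J)) disjoint
    where
    disjoint : ∀ {v} → ¬ (v ∈ map src (allFin 3) × v ∈ map ctr (allFin J))
    disjoint (v∈ , v∈′) with ∈-map⁻ src v∈ | ∈-map⁻ ctr v∈′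
    ... | _ , _ , refl | _ , _ , ()

  K-length : length (map from K) ≡ J + 3
  K-length = begin
    length (map from K)              ≡⟨ length-map from K ⟩
    3 + length (map ctr (allFin J))  ≡⟨ cong (3 +_) (length-listing ctr) ⟩
    3 + J                            ≡⟨ +-comm 3 J ⟩
    J + 3                            ∎
    where open ≡-Reasoning

  data Member : Vertex → Set where
    source : ∀ s → Member (src s)
    centre : ∀ c → Member (ctr c)

  member : ∀ {x} → x ∈ K → Member x
  member x∈ with ∈-++⁻ (map src (allFin 3)) x∈
  ... | inj₁ x∈src with ∈-map⁻ src x∈src
  ...   | s , _ , refl = source s
  member x∈ | inj₂ x∈ctr with ∈-map⁻ ctr x∈ctr
  ...   | c , _ , refl = centre c

  atCentre : ∀ {s s′} c → s ≢ missing c → s′ ≢ missing c → Adjacent (src s) (src s′)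
  atCentre c s≢ s′≢ = inj₂ (inj₂ (ctr c , src⇒ctr s≢ , src⇒ctr s′≢))

  sourcesMeet : ∀ s s′ → s ≢ s′ → Adjacent (src s) (src s′)
  sourcesMeet zero                (suc zero)          _ = atCentre (suc (suc zero)) (λ ()) (λ ())
  sourcesMeet zero                (suc (suc zero))    _ = atCentre (suc zero) (λ ()) (λ ())
  sourcesMeet (suc zero)          zero                _ = atCentre (suc (suc zero)) (λ ()) (λ ())
  sourcesMeet (suc zero)          (suc (suc zero))    _ = atCentre zero (λ ()) (λ ())
  sourcesMeet (suc (suc zero))    zero                _ = atCentre (suc zero) (λ ()) (λ ())
  sourcesMeet (suc (suc zero))    (suc zero)          _ = atCentre zero (λ ()) (λ ())
  sourcesMeet zero                zero                s≢s = ⊥-elim (s≢s refl)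
  sourcesMeet (suc zero)          (suc zero)          s≢s = ⊥-elim (s≢s refl)
  sourcesMeet (suc (suc zero))    (suc (suc zero))    s≢s = ⊥-elim (s≢s refl)

  sourceCentre : ∀ s c → Adjacent (src s) (ctr c)
  sourceCentre s c with s ≟ missing c
  ... | yes refl = inj₂ (inj₂ (priv c , src⇒priv , ctr⇒priv))
  ... | no  s≢   = inj₁ (src⇒ctr s≢)

  centresMeet : ∀ c d → c ≢ d → Adjacent (ctr c) (ctr d)
  centresMeet c d c≢d with <-cmp c d
  ... | tri< c<d _ _ = inj₂ (inj₂ (mid c d , ctr⇒midˡ c<d , ctr⇒midʳ c<d))
  ... | tri≈ _ c≡d _ = ⊥-elim (c≢d c≡d)
  ... | tri> _ _ d<c = inj₂ (inj₂ (mid d c , ctr⇒midʳ d<c , ctr⇒midˡ d<c))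

  K-adjacent : ∀ {x y} → x ∈ K → y ∈ K → x ≢ y → Adjacent x y
  K-adjacent x∈ y∈ x≢y with member x∈ | member y∈
  ... | source s | source s′ = sourcesMeet s s′ λ { refl → x≢y refl }
  ... | source s | centre c  = sourceCentre s c
  ... | centre c | source s  = Adjacent-sym (sourceCentre s c)
  ... | centre c | centre d  = centresMeet c d λ { refl → x≢y refl }

  tight : ∃ λ D → Is2j J D × CliqueNumberEq D (bound J)
  tight = digraph , is2j , upperBound (suc (suc m)) digraph is2j ,
          map from K , clique K K-unique K-adjacent , K-length

theorem3p9 : (∀ (j : ℕ) (D : Digraph) → Is2j (suc j) D → CliqueNumberLE D (bound (suc j)))
    × (∀ (j : ℕ) → ∃ (λ D → Is2j (suc j) D × CliqueNumberEq D (bound (suc j))))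
theorem3p9 = upperBound , tight
  where
  tight : ∀ (j : ℕ) → ∃ (λ D → Is2j (suc j) D × CliqueNumberEq D (bound (suc j)))
  tight zero          = tight₁
  tight (suc zero)    = tight₂
  tight (suc (suc m)) = Construction.tight m
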